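{- Let $(G,A)$ be a simple connected edge-weighted graph and let $v$ and $w$ be distinct vertices of $G$. Then: (1) $G$ can be collapsed to the graph $K_2$ with vertices $v$ and $w$, i.e. a finite sequence of collapsing operations transforms $(G,A)$ into a graph whose only vertices are $v$ and $w$, joined by a single edge. (2) $G$ can be collapsed to the single vertex $v$.
   Context: An edge-weighted graph $(G,A)$ is a finite loopless graph (multiple edges allowed) with a weight function $A$ from its edges to positive integers. The collapsing operations are: (a) the star-clique operation, applied to a vertex $v$ of a graph with no multiple edges: if $v$ has neighbours $w_1,\dots,w_d$ with edge $vw_k$ of weight $a_k$, delete $v$ and its incident edges and, for each pair $j<k$, add a new edge between $w_j$ and $w_k$ of weight $\gcd(a_j,a_k)$ (possibly creating multiple edges), leaving all other vertices and edges unchanged; (b) edge collapse: replace edges $e_1,\dots,e_r$ ($r\ge2$) joining the same pair of vertices, of weights $a_1,\dots,a_r$, by a single edge joining that pair of weight $\operatorname{lcm}(a_1,\dots,a_r)$. -}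

module Defs where

open import Data.Nat using (ℕ; _≤_; _<_)
open import Data.Nat.GCD using (gcd)
open import Data.Nat.LCM using (lcm)
open import Data.Fin using (Fin; _≟_)
open import Data.List using (List; []; _∷_; [_]; _++_; map; length; foldr)
open import Data.List.Membership.Propositional using (_∈_)
open import Data.List.Relation.Unary.All using (All)
open import Data.List.Relation.Unary.AllPairs using (AllPairs)
open import Data.List.Relation.Unary.Unique.Propositional using (Unique)
open import Data.List.Relation.Binary.Permutation.Propositional using (_↭_)
open import Data.Product using (_×_; _,_; ∃; ∃-syntax)
open import Data.Sum using (_⊎_)
open import Data.Bool using (if_then_else_)
open import Relation.Nullary using (¬_)
open import Relation.Nullary.Decidable using (⌊_⌋)
open import Relation.Binary.PropositionalEquality using (_≡_; _≢_)
open import Relation.Binary.Construct.Closure.ReflexiveTransitive using (Star)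

-- Vertices are labelled by Fin n.  An edge joins the unordered pair {end₁, end₂}
-- and carries a weight.
record Edge (n : ℕ) : Set where
  constructor edge
  field
    end₁ end₂ : Fin n
    wt        : ℕ
open Edge public

-- An edge-weighted (multi)graph: a list of vertices and a list (multiset) of edges.
record Graph (n : ℕ) : Set where
  constructor graph
  field
    verts : List (Fin n)
    edges : List (Edge n)
open Graph public

module _ {n : ℕ} where

  Joins : Edge n → Fin n → Fin n → Set
  Joins e x y = (end₁ e ≡ x × end₂ e ≡ y) ⊎ (end₁ e ≡ y × end₂ e ≡ x)

  SamePair : Edge n → Edge n → Set
  SamePair e f = Joins f (end₁ e) (end₂ e)

  Incident : Fin n → Edge n → Set
  Incident v e = end₁ e ≡ v ⊎ end₂ e ≡ v

  -- the endpoint of e other than v (for e incident to v)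
  other : Fin n → Edge n → Fin n
  other v e = if ⌊ end₁ e ≟ v ⌋ then end₂ e else end₁ e

  NoMultiEdges : List (Edge n) → Set
  NoMultiEdges = AllPairs (λ e f → ¬ SamePair e f)

  WellFormed : Graph n → Set
  WellFormed G =
    Unique (verts G) ×
    All (λ e → end₁ e ∈ verts G × end₂ e ∈ verts G × end₁ e ≢ end₂ e × 0 < wt e) (edges G)

  Simple : Graph n → Set
  Simple G = WellFormed G × NoMultiEdges (edges G)

  Adjacent : Graph n → Fin n → Fin n → Set
  Adjacent G x y = ∃[ e ] (e ∈ edges G × Joins e x y)

  Connected : Graph n → Set
  Connected G = ∀ {x y} → x ∈ verts G → y ∈ verts G → Star (Adjacent G) x y

  clique : List (Fin n × ℕ) → List (Edge n)
  clique []             = []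
  clique ((x , a) ∷ xs) = map (λ { (y , b) → edge x y (gcd a b) }) xs ++ clique xs

  lcmList : List ℕ → ℕ
  lcmList = foldr lcm 1

  -- One collapsing operation (graphs considered up to reordering of the
  -- vertex and edge lists).
  data Step : Graph n → Graph n → Set where
    star-clique : ∀ {vs es vs' es'} (v : Fin n) (I R : List (Edge n)) →
      NoMultiEdges es →
      vs ↭ (v ∷ vs') →
      es ↭ (I ++ R) →
      All (Incident v) I →
      All (λ e → ¬ Incident v e) R →
      es' ↭ (R ++ clique (map (λ e → other v e , wt e) I)) →
      Step (graph vs es) (graph vs' es')
    edge-collapse : ∀ {vs es es'} (x y : Fin n) (E R : List (Edge n)) →
      2 ≤ length E →
      All (λ e → Joins e x y) E →
      es ↭ (E ++ R) →
      es' ↭ (edge x y (lcmList (map wt E)) ∷ R) →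
      Step (graph vs es) (graph vs es')

  CollapsesTo : Graph n → Graph n → Set
  CollapsesTo = Star Step

  IsK2 : Fin n → Fin n → Graph n → Set
  IsK2 v w H = (verts H ↭ (v ∷ w ∷ [])) × ∃[ e ] (edges H ≡ [ e ] × Joins e v w)

  IsPoint : Fin n → Graph n → Set
  IsPoint v H = (verts H ≡ [ v ]) × (edges H ≡ [])

-- Eliminate the vertices other than v and w one at a time.  Before each
-- elimination, edge collapses merge every bundle of parallel edges, so the
-- graph has no multiple edges and the star-clique operation applies to the
-- next vertex u.  Deleting u keeps the remaining vertices connected: a walk
-- x — u — z is replaced by the clique edge x — z.  When only v and w are left,
-- all edges join v and w, and there is at least one since v and w are
-- connected; collapsing them yields K₂, and a last star-clique at w yields
-- the single vertex v.
module Submission where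

open import Defs
open import Data.Nat using (ℕ; _≤_; s≤s; z≤n)
open import Data.Fin using (Fin; _≟_)
open import Data.List using (List; []; _∷_; [_]; _++_; map; filter; length)
open import Data.List.Properties using (partition-defn)
open import Data.List.Membership.Propositional using (_∈_)
open import Data.List.Membership.Propositional.Properties
  using (∈-map⁺; ∈-++⁺ˡ; ∈-++⁺ʳ; ∈-++⁻; ∈-filter⁺; ∈-filter⁻; ∈-∃++)
open import Data.List.Relation.Unary.Any using (here; there)
open import Data.List.Relation.Unary.All as All using (All; []; _∷_)
import Data.List.Relation.Unary.All.Properties as Allₚ
open import Data.List.Relation.Unary.AllPairs using (AllPairs; []; _∷_)
import Data.List.Relation.Unary.AllPairs.Properties as AllPairsₚ
open import Data.List.Relation.Unary.Unique.Propositional using (Unique)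
open import Data.List.Relation.Binary.Permutation.Propositional
  using (_↭_; ↭-refl; ↭-sym; ↭-trans; prep; swap; ↭⇒↭ₛ; ↭ₛ⇒↭)
open import Data.List.Relation.Binary.Permutation.Propositional.Properties
  using (∈-resp-↭; All-resp-↭; shift; ++-identityʳ)
import Data.List.Relation.Binary.Permutation.Setoid.Properties as Setoid↭
open import Data.Product using (_×_; _,_; proj₁; ∃-syntax)
open import Data.Sum using (_⊎_; inj₁; inj₂)
open import Data.Empty using (⊥-elim)
open import Function using (_on_)
open import Relation.Nullary using (¬_; yes; no; Dec)
open import Relation.Nullary.Decidable using (_×-dec_; _⊎-dec_)
open import Relation.Unary using (Pred; Decidable)
open import Relation.Unary.Properties using (∁?)
open import Relation.Binary.PropositionalEquality using (_≡_; _≢_; refl; sym; subst; setoid)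
open import Relation.Binary.Construct.Closure.ReflexiveTransitive as Star
  using (Star; ε; _◅_; _◅◅_)

module _ {a} {A : Set a} where

  filter-↭ : ∀ {p} {P : Pred A p} (P? : Decidable P) (xs : List A) →
    xs ↭ filter P? xs ++ filter (∁? P?) xs
  filter-↭ P? xs = subst (λ { (ys , zs) → xs ↭ ys ++ zs }) (partition-defn P? xs)
    (↭ₛ⇒↭ (Setoid↭.partition-↭ (setoid A) P? xs))

  Unique-resp-↭ : ∀ {xs ys : List A} → xs ↭ ys → Unique xs → Unique ys
  Unique-resp-↭ p = Setoid↭.Unique-resp-↭ (setoid A) (↭⇒↭ₛ p)

  ∈⇒↭∷ : ∀ {x : A} {xs} → x ∈ xs → ∃[ ys ] (xs ↭ x ∷ ys)
  ∈⇒↭∷ x∈xs with ys , zs , refl ← ∈-∃++ x∈xs = ys ++ zs , shift _ ys zs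

  ∈-↭∷⁻ : ∀ {x u : A} {xs ys} → xs ↭ u ∷ ys → x ∈ xs → x ≢ u → x ∈ ys
  ∈-↭∷⁻ p x∈xs x≢u with ∈-resp-↭ p x∈xs
  ... | here x≡u  = ⊥-elim (x≢u x≡u)
  ... | there x∈ys = x∈ys

  ∈∈⇒↭∷∷ : ∀ {v w : A} {xs} → v ∈ xs → w ∈ xs → v ≢ w → ∃[ ys ] (xs ↭ v ∷ w ∷ ys)
  ∈∈⇒↭∷∷ v∈xs w∈xs v≢w
    with ys , xs↭ ← ∈⇒↭∷ v∈xs
    with zs , ys↭ ← ∈⇒↭∷ (∈-↭∷⁻ xs↭ w∈xs (λ w≡v → v≢w (sym w≡v)))
    = zs , ↭-trans xs↭ (prep _ ys↭)

module _ {n : ℕ} where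

  private variable
    u x y z : Fin n
    e f : Edge n
    V vs vs' : List (Fin n)
    es es' X : List (Edge n)

  Loopless : Edge n → Set
  Loopless e = end₁ e ≢ end₂ e

  EdgeOn : List (Fin n) → Edge n → Set
  EdgeOn V e = end₁ e ∈ V × end₂ e ∈ V × Loopless e

  Adj : List (Edge n) → Fin n → Fin n → Set
  Adj es x y = ∃[ e ] (e ∈ es × Joins e x y)

  Walk : List (Edge n) → Fin n → Fin n → Set
  Walk es = Star (Adj es)

  Joins? : (e : Edge n) (x y : Fin n) → Dec (Joins e x y)
  Joins? e x y = ((end₁ e ≟ x) ×-dec (end₂ e ≟ y)) ⊎-dec ((end₁ e ≟ y) ×-dec (end₂ e ≟ x))

  SamePair? : (e f : Edge n) → Dec (SamePair e f)
  SamePair? e f = Joins? f (end₁ e) (end₂ e)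

  Incident? : (u : Fin n) → Decidable (Incident u)
  Incident? u e = (end₁ e ≟ u) ⊎-dec (end₂ e ≟ u)

  SamePair-sym : SamePair e f → SamePair f e
  SamePair-sym {e = edge _ _ _} {f = edge _ _ _} (inj₁ (refl , refl)) = inj₁ (refl , refl)
  SamePair-sym {e = edge _ _ _} {f = edge _ _ _} (inj₂ (refl , refl)) = inj₂ (refl , refl)

  Joins-sym : Joins e x y → Joins e y x
  Joins-sym (inj₁ (p , q)) = inj₂ (p , q)
  Joins-sym (inj₂ (p , q)) = inj₁ (p , q)

  Joins⇒SamePair : Joins e x y → Joins f x y → SamePair e f
  Joins⇒SamePair {e = edge _ _ _} (inj₁ (refl , refl)) (inj₁ (p , q)) = inj₁ (p , q)
  Joins⇒SamePair {e = edge _ _ _} (inj₁ (refl , refl)) (inj₂ (p , q)) = inj₂ (p , q)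
  Joins⇒SamePair {e = edge _ _ _} (inj₂ (refl , refl)) (inj₁ (p , q)) = inj₂ (p , q)
  Joins⇒SamePair {e = edge _ _ _} (inj₂ (refl , refl)) (inj₂ (p , q)) = inj₁ (p , q)

  Joins-resp-SamePair : SamePair e f → Joins e x y → Joins f x y
  Joins-resp-SamePair {e = edge _ _ _} {edge _ _ _} (inj₁ (refl , refl)) J = J
  Joins-resp-SamePair {e = edge _ _ _} {edge _ _ _} (inj₂ (refl , refl)) (inj₁ (p , q)) = inj₂ (q , p)
  Joins-resp-SamePair {e = edge _ _ _} {edge _ _ _} (inj₂ (refl , refl)) (inj₂ (p , q)) = inj₁ (q , p)

  Joins⇒Incidentʳ : Joins e x u → Incident u e
  Joins⇒Incidentʳ (inj₁ (_ , p)) = inj₂ p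
  Joins⇒Incidentʳ (inj₂ (p , _)) = inj₁ p

  Joins⇒¬Incident : Joins e x z → x ≢ u → z ≢ u → ¬ Incident u e
  Joins⇒¬Incident {e = edge _ _ _} (inj₁ (refl , refl)) x≢u _ (inj₁ p) = x≢u p
  Joins⇒¬Incident {e = edge _ _ _} (inj₁ (refl , refl)) _ z≢u (inj₂ p) = z≢u p
  Joins⇒¬Incident {e = edge _ _ _} (inj₂ (refl , refl)) _ z≢u (inj₁ p) = z≢u p
  Joins⇒¬Incident {e = edge _ _ _} (inj₂ (refl , refl)) x≢u _ (inj₂ p) = x≢u p

  Joins⇒≢ : Loopless e → Joins e x y → x ≢ y
  Joins⇒≢ {e = edge _ _ _} a≢b (inj₁ (refl , refl)) = a≢b
  Joins⇒≢ {e = edge _ _ _} a≢b (inj₂ (refl , refl)) = λ b≡a → a≢b (sym b≡a)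

  EdgeOn-Joins : EdgeOn V e → Joins e x y → x ∈ V × y ∈ V × x ≢ y
  EdgeOn-Joins {e = edge _ _ _} (a∈ , b∈ , a≢b) (inj₁ (refl , refl)) = a∈ , b∈ , a≢b
  EdgeOn-Joins {e = edge _ _ _} (a∈ , b∈ , a≢b) (inj₂ (refl , refl)) =
    b∈ , a∈ , λ b≡a → a≢b (sym b≡a)

  EdgeOn-resp-SamePair : SamePair e f → EdgeOn V e → EdgeOn V f
  EdgeOn-resp-SamePair {e = e} {f = f} e∥f onV =
    EdgeOn-Joins {e = e} onV (SamePair-sym {e = e} {f = f} e∥f)

  EdgeOn-pair⇒Joins : vs ↭ x ∷ y ∷ [] → EdgeOn vs e → Joins e x y
  EdgeOn-pair⇒Joins {e = edge _ _ _} vs↭ (a∈ , b∈ , a≢b) with ∈-resp-↭ vs↭ a∈ | ∈-resp-↭ vs↭ b∈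
  ... | here refl         | here refl         = ⊥-elim (a≢b refl)
  ... | here refl         | there (here refl) = inj₁ (refl , refl)
  ... | there (here refl) | here refl         = inj₂ (refl , refl)
  ... | there (here refl) | there (here refl) = ⊥-elim (a≢b refl)

  other-Joins : Incident u e → Joins e u (other u e)
  other-Joins {u = u} {e = edge a _ _} inc with a ≟ u | inc
  ... | yes refl | _       = inj₁ (refl , refl)
  ... | no a≢u   | inj₁ p  = ⊥-elim (a≢u p)
  ... | no _     | inj₂ p  = inj₂ (refl , p)

  other-unique : Joins e x u → x ≢ u → other u e ≡ x
  other-unique {e = edge a b _} {u = u} J x≢u with a ≟ u | J
  ... | yes refl | inj₁ (a≡x , _) = ⊥-elim (x≢u (sym a≡x))
  ... | yes refl | inj₂ (_ , b≡x) = b≡x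
  ... | no _     | inj₁ (a≡x , _) = a≡x
  ... | no a≢u   | inj₂ (a≡u , _) = ⊥-elim (a≢u a≡u)

  Walk-[] : Walk [] x y → x ≡ y
  Walk-[] ε = refl
  Walk-[] ((_ , () , _) ◅ _)

  Adj-++⁺ʳ : ∀ R {S x y} → Adj S x y → Adj (R ++ S) x y
  Adj-++⁺ʳ R (e , e∈S , J) = e , ∈-++⁺ʳ R e∈S , J

  -- The edge-collapse operation acting on edge lists alone, so that it can be
  -- performed underneath further edges (Collapse-∷).
  data Collapse : List (Edge n) → List (Edge n) → Set where
    collapse : ∀ {es es'} (x y : Fin n) (E R : List (Edge n)) →
      2 ≤ length E → All (λ e → Joins e x y) E → es ↭ E ++ R →
      es' ↭ edge x y (lcmList {n} (map wt E)) ∷ R → Collapse es es'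

  Collapse⇒Step : ∀ vs → Collapse es es' → Step (graph vs es) (graph vs es')
  Collapse⇒Step vs (collapse x y E R 2≤∣E∣ E-xy es↭ es'↭) =
    edge-collapse x y E R 2≤∣E∣ E-xy es↭ es'↭

  Collapse-∷ : ∀ e → Collapse es es' → Collapse (e ∷ es) (e ∷ es')
  Collapse-∷ e (collapse x y E R 2≤∣E∣ E-xy es↭ es'↭) =
    collapse x y E (e ∷ R) 2≤∣E∣ E-xy (↭-trans (prep e es↭) (↭-sym (shift e E R)))
      (↭-trans (prep e es'↭) (swap e _ ↭-refl))

  Adj-Collapse : Collapse es es' → Adj es x y → Adj es' x y
  Adj-Collapse (collapse x y E _ _ E-xy es↭ es'↭) (e , e∈es , J)
    with ∈-++⁻ E (∈-resp-↭ es↭ e∈es)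
  ... | inj₁ e∈E = new , ∈-resp-↭ (↭-sym es'↭) (here refl) ,
                   Joins-resp-SamePair {e = e} {new}
                     (SamePair-sym {e = new} {e} (All.lookup E-xy e∈E)) J
    where
    new : Edge n
    new = edge x y (lcmList {n} (map wt E))
  ... | inj₂ e∈R = e , ∈-resp-↭ (↭-sym es'↭) (there e∈R) , J

  Walk-Collapses : Star Collapse es es' → Walk es x y → Walk es' x y
  Walk-Collapses ε walk = walk
  Walk-Collapses (c ◅ cs) walk = Walk-Collapses cs (Star.map (Adj-Collapse c) walk)

  Collapses⇒CollapsesTo : ∀ vs → Star Collapse es es' →
    CollapsesTo (graph vs es) (graph vs es')
  Collapses⇒CollapsesTo vs = Star.gmap (graph vs) (Collapse⇒Step vs)

  collapse-parallel-edges : ∀ e es → All (λ f → Joins f x y) (e ∷ es) →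
    ∃[ f ] (CollapsesTo (graph vs (e ∷ es)) (graph vs [ f ]) × Joins f x y)
  collapse-parallel-edges e [] (e-xy ∷ []) = e , ε , e-xy
  collapse-parallel-edges {x = x} {y} e (f ∷ es) all-xy =
    _ , edge-collapse x y (e ∷ f ∷ es) [] (s≤s (s≤s z≤n)) all-xy
          (↭-sym (++-identityʳ _)) ↭-refl ◅ ε ,
    inj₁ (refl , refl)

  absorb-parallels : ∀ e X → NoMultiEdges X →
    ∃[ Y ] (Star Collapse (e ∷ X) Y × NoMultiEdges Y × All (λ g → SamePair e g ⊎ g ∈ X) Y)
  absorb-parallels e X simple
    with filter (SamePair? e) X | Allₚ.all-filter (SamePair? e) X | filter-↭ (SamePair? e) X
  ... | [] | [] | X↭R =
    e ∷ X , ε ,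
    All-resp-↭ (↭-sym X↭R) (Allₚ.all-filter (∁? (SamePair? e)) X) ∷ simple ,
    inj₁ (inj₁ (refl , refl)) ∷ All.tabulate (λ g∈X → inj₂ g∈X)
  ... | f ∷ F | e∥f ∷ e∥F | X↭ =
    _ , collapse (end₁ e) (end₂ e) (e ∷ f ∷ F) _ (s≤s (s≤s z≤n))
          (inj₁ (refl , refl) ∷ e∥f ∷ e∥F) (prep e X↭) ↭-refl ◅ ε ,
    Allₚ.all-filter (∁? (SamePair? e)) X ∷ AllPairsₚ.filter⁺ (∁? (SamePair? e)) simple ,
    inj₁ (inj₁ (refl , refl)) ∷
      All.tabulate (λ g∈R → inj₂ (proj₁ (∈-filter⁻ (∁? (SamePair? e)) g∈R)))

  Parallel : List (Edge n) → Edge n → Set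
  Parallel es f = ∃[ e ] (e ∈ es × SamePair e f)

  collapse-multi-edges : ∀ es →
    ∃[ X ] (Star Collapse es X × NoMultiEdges X × All (Parallel es) X)
  collapse-multi-edges [] = [] , ε , [] , []
  collapse-multi-edges (e ∷ es)
    with X , steps , simple , parallel ← collapse-multi-edges es
    with Y , steps' , simple' , origin ← absorb-parallels e X simple
    = Y , Star.gmap (e ∷_) (Collapse-∷ e) steps ◅◅ steps' , simple' , All.map parallel-∷ origin
    where
    parallel-∷ : ∀ {g} → SamePair e g ⊎ g ∈ X → Parallel (e ∷ es) g
    parallel-∷ (inj₁ e∥g) = e , here refl , e∥g
    parallel-∷ (inj₂ g∈X) with f , f∈es , f∥g ← All.lookup parallel g∈X =
      f , there f∈es , f∥g

  EdgeOn-Parallel : All (EdgeOn V) es → Parallel es f → EdgeOn V f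
  EdgeOn-Parallel {f = f} onV (e , e∈es , e∥f) =
    EdgeOn-resp-SamePair {e = e} {f = f} e∥f (All.lookup onV e∈es)

  neighbours : Fin n → List (Edge n) → List (Fin n × ℕ)
  neighbours u I = map (λ e → other u e , wt e) I

  star-clique-edges : Fin n → List (Edge n) → List (Edge n)
  star-clique-edges u X =
    filter (∁? (Incident? u)) X ++ clique (neighbours u (filter (Incident? u) X))

  clique-Adj : ∀ xs {a b p q} → (a , p) ∈ xs → (b , q) ∈ xs → a ≢ b → Adj (clique xs) a b
  clique-Adj (_ ∷ _) (here refl) (here refl) a≢b = ⊥-elim (a≢b refl)
  clique-Adj (_ ∷ _) (here refl) (there b∈) _ = _ , ∈-++⁺ˡ (∈-map⁺ _ b∈) , inj₁ (refl , refl)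
  clique-Adj (_ ∷ _) (there a∈) (here refl) _ = _ , ∈-++⁺ˡ (∈-map⁺ _ a∈) , inj₂ (refl , refl)
  clique-Adj (_ ∷ xs) (there a∈) (there b∈) a≢b = Adj-++⁺ʳ _ (clique-Adj xs a∈ b∈ a≢b)

  clique-EdgeOn : ∀ xs → AllPairs (_≢_ on proj₁) xs → All (λ s → proj₁ s ∈ V) xs →
    All (EdgeOn V) (clique xs)
  clique-EdgeOn [] _ _ = []
  clique-EdgeOn (_ ∷ xs) (x≢xs ∷ distinct) (x∈V ∷ xs∈V) =
    Allₚ.++⁺ (Allₚ.map⁺ (All.zipWith (λ (y∈V , x≢y) → x∈V , y∈V , x≢y) (xs∈V , x≢xs)))
             (clique-EdgeOn xs distinct xs∈V)

  neighbours-distinct : ∀ {I} → NoMultiEdges I → All (Incident u) I →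
    AllPairs (_≢_ on proj₁) (neighbours u I)
  neighbours-distinct [] [] = []
  neighbours-distinct {u = u} {I = e ∷ _} (e∦I ∷ simple) (inc ∷ incs) =
    Allₚ.map⁺ (All.zipWith (λ { {f} (e∦f , inc') same →
      e∦f (Joins⇒SamePair {e = e} {f = f}
        (other-Joins {e = e} inc) (subst (Joins f u) (sym same) (other-Joins {e = f} inc'))) })
      (e∦I , incs))
    ∷ neighbours-distinct simple incs

  star-clique-Step : vs ↭ u ∷ vs' → NoMultiEdges X →
    Step (graph vs X) (graph vs' (star-clique-edges u X))
  star-clique-Step {u = u} {X = X} vs↭ simple =
    star-clique u _ _ simple vs↭ (filter-↭ (Incident? u) X)
      (Allₚ.all-filter (Incident? u) X) (Allₚ.all-filter (∁? (Incident? u)) X) ↭-refl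

  star-clique-EdgeOn : vs ↭ u ∷ vs' → NoMultiEdges X → All (EdgeOn vs) X →
    All (EdgeOn vs') (star-clique-edges u X)
  star-clique-EdgeOn {u = u} {X = X} vs↭ simple onV = Allₚ.++⁺ kept new
    where
    kept : All (EdgeOn _) (filter (∁? (Incident? u)) X)
    kept = All.tabulate λ e∈ → let (e∈X , ¬inc) = ∈-filter⁻ (∁? (Incident? u)) e∈
                                   (a∈ , b∈ , a≢b) = All.lookup onV e∈X
                               in ∈-↭∷⁻ vs↭ a∈ (λ p → ¬inc (inj₁ p)) ,
                                  ∈-↭∷⁻ vs↭ b∈ (λ p → ¬inc (inj₂ p)) , a≢b
    new : All (EdgeOn _) (clique (neighbours u (filter (Incident? u) X)))
    new = clique-EdgeOn _
      (neighbours-distinct (AllPairsₚ.filter⁺ (Incident? u) simple)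
                           (Allₚ.all-filter (Incident? u) X))
      (Allₚ.map⁺ (All.tabulate λ {e} e∈ →
        let (e∈X , inc) = ∈-filter⁻ (Incident? u) e∈
            (_ , o∈ , u≢o) =
              EdgeOn-Joins {e = e} (All.lookup onV e∈X) (other-Joins {e = e} inc)
        in ∈-↭∷⁻ vs↭ o∈ (λ o≡u → u≢o (sym o≡u))))

  -- Each visit x — u — z is replaced by the clique edge x — z (or dropped if
  -- x = z); looplessness guarantees z ≢ u.
  star-clique-Walk : All Loopless X → x ≢ u → y ≢ u →
    Walk X x y → Walk (star-clique-edges u X) x y
  star-clique-Walk _ _ _ ε = ε
  star-clique-Walk {X = X} {x = x} {u = u} loopless x≢u y≢u (_◅_ {j = z} (e , e∈X , xz) walk)
    with z ≟ u
  ... | no z≢u =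
    (e , ∈-++⁺ˡ (∈-filter⁺ (∁? (Incident? u)) e∈X (Joins⇒¬Incident {e = e} xz x≢u z≢u)) , xz)
      ◅ star-clique-Walk loopless z≢u y≢u walk
  ... | yes refl with walk
  ...   | ε = ⊥-elim (y≢u refl)
  ...   | _◅_ {j = z'} (f , f∈X , uz') walk' with x ≟ z'
  ...     | yes refl = star-clique-Walk loopless x≢u y≢u walk'
  ...     | no x≢z' =
    Adj-++⁺ʳ _ (clique-Adj _ (neighbour e∈X xz x≢u)
                             (neighbour f∈X (Joins-sym {e = f} uz') z'≢u) x≢z')
      ◅ star-clique-Walk loopless z'≢u y≢u walk'
    where
    z'≢u : z' ≢ u
    z'≢u z'≡u = Joins⇒≢ {e = f} (All.lookup loopless f∈X) uz' (sym z'≡u)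
    neighbour : ∀ {g a} → g ∈ X → Joins g a u → a ≢ u →
      (a , wt g) ∈ neighbours u (filter (Incident? u) X)
    neighbour {g} g∈X J a≢u = subst (λ o → (o , wt g) ∈ _) (other-unique {e = g} J a≢u)
      (∈-map⁺ _ (∈-filter⁺ (Incident? u) g∈X (Joins⇒Incidentʳ {e = g} J)))

  eliminate-vertex : vs ↭ u ∷ vs' → All (EdgeOn vs) es →
    ∃[ es' ] (CollapsesTo (graph vs es) (graph vs' es') × All (EdgeOn vs') es' ×
              (∀ {x y} → x ≢ u → y ≢ u → Walk es x y → Walk es' x y))
  eliminate-vertex {vs = vs} {u = u} {es = es} vs↭ onV
    with X , collapses , simple , parallel ← collapse-multi-edges es
    = star-clique-edges u X ,
      Collapses⇒CollapsesTo vs collapses ◅◅ star-clique-Step vs↭ simple ◅ ε ,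
      star-clique-EdgeOn vs↭ simple onX ,
      λ x≢u y≢u walk → star-clique-Walk (All.map (λ (_ , _ , loopless) → loopless) onX)
                         x≢u y≢u (Walk-Collapses collapses walk)
    where
    onX : All (EdgeOn vs) X
    onX = All.map (λ {f} → EdgeOn-Parallel {f = f} onV) parallel

  collapse-to-K2 : ∀ {v w : Fin n} others → vs ↭ v ∷ w ∷ others → Unique (v ∷ w ∷ others) →
    All (EdgeOn vs) es → Walk es v w → ∃[ H ] (CollapsesTo (graph vs es) H × IsK2 v w H)
  collapse-to-K2 {es = []} [] _ ((v≢w ∷ []) ∷ _) _ walk = ⊥-elim (v≢w (Walk-[] walk))
  collapse-to-K2 {vs = vs} {es = e ∷ es} [] vs↭ _ onV _
    with f , collapses , f-vw ←
           collapse-parallel-edges e es (All.map (λ {g} → EdgeOn-pair⇒Joins {e = g} vs↭) onV)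
    = graph vs [ f ] , collapses , vs↭ , f , refl , f-vw
  collapse-to-K2 (u ∷ others) vs↭ ((v≢w ∷ v≢u ∷ v∉) ∷ (w≢u ∷ w∉) ∷ (_ ∷ unique)) onV walk
    with es' , collapses , onV' , bypass ←
           eliminate-vertex (↭-trans vs↭ (shift u (_ ∷ _ ∷ []) others)) onV
    with H , collapses' , isK2 ←
           collapse-to-K2 others ↭-refl ((v≢w ∷ v∉) ∷ w∉ ∷ unique) onV' (bypass v≢u w≢u walk)
    = H , collapses ◅◅ collapses' , isK2

  K2-collapses-to-point : ∀ {v w : Fin n} H → IsK2 v w H → ∃[ K ] (Step H K × IsPoint v K)
  K2-collapses-to-point {v} {w} (graph _ ._) (vs↭ , e , refl , e-vw) =
    graph [ v ] [] ,
    star-clique w [ e ] [] ([] ∷ []) (↭-trans vs↭ (swap v w ↭-refl)) ↭-refl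
      (Joins⇒Incidentʳ {e = e} e-vw ∷ []) [] ↭-refl ,
    refl , refl

lemma2p9 : (n : ℕ) (G : Graph n) → Simple G → Connected G →
    (v w : Fin n) → v ∈ verts G → w ∈ verts G → v ≢ w →
    (∃[ H ] (CollapsesTo G H × IsK2 v w H)) × (∃[ H ] (CollapsesTo G H × IsPoint v H))
lemma2p9 n (graph vs es) ((unique , well-formed) , _) connected v w v∈vs w∈vs v≢w
  with others , vs↭ ← ∈∈⇒↭∷∷ v∈vs w∈vs v≢w
  with K₂ , collapses , isK2 ← collapse-to-K2 others vs↭ (Unique-resp-↭ vs↭ unique)
         (All.map (λ (a∈ , b∈ , a≢b , _) → a∈ , b∈ , a≢b) well-formed) (connected v∈vs w∈vs)
  = let point , step , isPoint = K2-collapses-to-point K₂ isK2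
    in (K₂ , collapses , isK2) , (point , collapses ◅◅ step ◅ ε , isPoint)
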